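{- Let $T$ be a complete theory and $\xi_T$ its canonical model. For every $L([1],[\omega])$-formula $\phi$ and all $\langle k,l\rangle\in\omega\times\omega$: $\xi_T\models_{\langle k,l\rangle}\phi$ if and only if $T\vdash[\omega]^k[1]^l\phi$.
   Context: Let $Var=\{p_n : n\in\omega\}$. Formulas are built from $Var$ using unary $\lnot$, $[1]$, $[\omega]$ and binary $\land$, $\mathtt u$, $\mathtt U$; $L([1],[\omega])$-formulas are those built from $Var$ using only $\lnot,\land,[1],[\omega]$. $\lor,\to,\leftrightarrow$ are defined as usual; $\mathtt f\phi:=(\phi\to\phi)\,\mathtt u\,\phi$, $\mathtt g\phi:=\lnot\mathtt f\lnot\phi$; $[a]^0\phi=\phi$, $[a]^{n+1}\phi=[a][a]^n\phi$ for $a\in\{1,\omega\}$. A theory is a nonempty set of formulas. Semantics: a model is $\xi:\omega\times\omega\times Var\to\{0,1\}$; time instants $\mathbf r=\langle r_1,r_2\rangle$ are ordered lexicographically; $\xi\models_{\mathbf r}p$ iff $\xi(r_1,r_2,p)=1$; $\lnot,\land$ classically; $\xi\models_{\mathbf r}[1]\phi$ iff $\xi\models_{\langle r_1,r_2+1\rangle}\phi$; $\xi\models_{\mathbf r}[\omega]\phi$ iff $\xi\models_{\langle r_1+1,0\rangle}\phi$; $\xi\models_{\mathbf r}\phi\,\mathtt u\,\psi$ iff there is $k\in\omega$ with $\xi\models_{\langle r_1,r_2+k\rangle}\psi$ and $\xi\models_{\langle r_1,r_2+i\rangle}\phi$ for $0\leqslant i<k$; $\xi\models_{\mathbf r}\phi\,\mathtt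 U\,\psi$ iff there is $\mathbf s\geqslant\mathbf r$ with $\xi\models_{\mathbf s}\psi$ and $\xi\models_{\mathbf t}\phi$ for all $\mathbf r\leqslant\mathbf t<\mathbf s$. Proof system: axioms are all instances of A1 tautology instances; A2 $[1][\omega]\phi\leftrightarrow[\omega]\phi$; A3 $\lnot[a]\phi\leftrightarrow[a]\lnot\phi$; A4 $[a](\phi*\psi)\leftrightarrow([a]\phi*[a]\psi)$, $*\in\{\land,\lor,\to,\leftrightarrow\}$ ($a\in\{1,\omega\}$); A5 $\psi\to(\phi\,\mathtt u\,\psi)$; A6 $\phi\,\mathtt u\,\psi\to\phi\,\mathtt U\,\psi$; A7 $\left(\bigwedge_{k=0}^n[1]^k(\phi\land\lnot\psi)\land[1]^{n+1}\psi\right)\to\phi\,\mathtt u\,\psi$; A8 $\left(\bigwedge_{k=0}^n[\omega]^k\mathtt g(\phi\land\lnot\psi)\land[\omega]^{n+1}(\phi\,\mathtt u\,\psi)\right)\to\phi\,\mathtt U\,\psi$. Rules: R1 modus ponens; R2 from $\phi$ infer $[a]\phi$; R3 from $\theta\to\lnot\psi$ and all $\theta\to\bigvee_{k=0}^n[1]^k(\lnot\phi\lor\psi)\lor[1]^{n+1}\lnot\psi$ ($n\in\omega$) infer $\theta\to\lnot(\phi\,\mathtt u\,\psi)$; R4 from $\theta\to\lnot(\phi\,\mathtt u\,\psi)$ and all $\theta\to\bigvee_{k=0}^n[\omega]^k\lnot\mathtt g(\phi\land\lnot\psi)\lor[\omega]^{n+1}\lnot(\phi\,\mathtt u\,\psi)$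 ($n\in\omega$) infer $\theta\to\lnot(\phi\,\mathtt U\,\psi)$. $T\vdash\phi$ iff there is a sequence of formulas of order type $\alpha+1$, $\alpha$ a countable ordinal, ending in $\phi$, each member an axiom, an element of $T$, or obtained from earlier members by a rule, necessitation being applied only to theorems (formulas so derivable from no premises). $T$ is consistent iff no $\chi$ has $T\vdash\chi$ and $T\vdash\lnot\chi$; complete iff consistent and for every $\phi$, $T\vdash\phi$ or $T\vdash\lnot\phi$. The canonical model of a complete theory $T$ is $\xi_T(k,l,p)=1$ iff $T\vdash[\omega]^k[1]^lp$. -}

module Defs where

open import Data.Nat using (ℕ; zero; suc; _+_; _≤_; _<_)
open import Data.Bool using (Bool; true; false; not; _∧_)
open import Data.Product using (Σ; ∃; _×_; _,_)
open import Data.Sum using (_⊎_; inj₁; inj₂)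
open import Data.Empty using (⊥)
open import Relation.Nullary using (¬_)
open import Relation.Binary.PropositionalEquality using (_≡_)

data Formula : Set where
  var  : ℕ → Formula
  ¬'_  : Formula → Formula
  _∧'_ : Formula → Formula → Formula
  [1]_ : Formula → Formula
  [ω]_ : Formula → Formula
  _u_  : Formula → Formula → Formula
  _U_  : Formula → Formula → Formula

infixr 9 ¬'_ [1]_ [ω]_
infixr 7 _∧'_
infixr 6 _∨'_
infixr 5 _⇒'_ _⇔'_
infix  8 _u_ _U_

_∨'_ : Formula → Formula → Formula
φ ∨' ψ = ¬' (¬' φ ∧' ¬' ψ)

_⇒'_ : Formula → Formula → Formula
φ ⇒' ψ = ¬' (φ ∧' ¬' ψ)

_⇔'_ : Formula → Formula → Formula
φ ⇔' ψ = (φ ⇒' ψ) ∧' (ψ ⇒' φ)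

fF : Formula → Formula
fF φ = (φ ⇒' φ) u φ

gF : Formula → Formula
gF φ = ¬' fF (¬' φ)

data Idx : Set where
  one omega : Idx

[_]_ : Idx → Formula → Formula
[ one ] φ = [1] φ
[ omega ] φ = [ω] φ

[_]^_ : Idx → ℕ → Formula → Formula
([ a ]^ zero) φ = φ
([ a ]^ suc n) φ = [ a ] (([ a ]^ n) φ)

⋀ : ℕ → (ℕ → Formula) → Formula
⋀ zero f = f zero
⋀ (suc n) f = ⋀ n f ∧' f (suc n)

⋁ : ℕ → (ℕ → Formula) → Formula
⋁ zero f = f zero
⋁ (suc n) f = ⋁ n f ∨' f (suc n)

-- L([1],[ω])-formulas: built using only ¬, ∧, [1], [ω]
data IsL : Formula → Set where
  var : ∀ n → IsL (var n)
  neg : ∀ {φ} → IsL φ → IsL (¬' φ)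
  and : ∀ {φ ψ} → IsL φ → IsL ψ → IsL (φ ∧' ψ)
  nx1 : ∀ {φ} → IsL φ → IsL ([1] φ)
  nxω : ∀ {φ} → IsL φ → IsL ([ω] φ)

-- Tautology instances (axiom A1): substitution instances of classical
-- propositional tautologies (built from ¬ and ∧; ∨,→,↔ are defined).

data PForm : Set where
  pv   : ℕ → PForm
  pneg : PForm → PForm
  pand : PForm → PForm → PForm

evalP : (ℕ → Bool) → PForm → Bool
evalP v (pv n) = v n
evalP v (pneg a) = not (evalP v a)
evalP v (pand a b) = evalP v a ∧ evalP v b

Tautology : PForm → Set
Tautology a = (v : ℕ → Bool) → evalP v a ≡ true

substP : (ℕ → Formula) → PForm → Formula
substP σ (pv n) = σ n
substP σ (pneg a) = ¬' substP σ a
substP σ (pand a b) = substP σ a ∧' substP σ b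

TautologyInstance : Formula → Set
TautologyInstance φ =
  Σ PForm λ a → Σ (ℕ → Formula) λ σ → Tautology a × (substP σ a ≡ φ)

data BinOp : Set where
  opAnd opOr opImp opIff : BinOp

bin : BinOp → Formula → Formula → Formula
bin opAnd φ ψ = φ ∧' ψ
bin opOr  φ ψ = φ ∨' ψ
bin opImp φ ψ = φ ⇒' ψ
bin opIff φ ψ = φ ⇔' ψ

data Axiom : Formula → Set where
  A1 : ∀ {φ} → TautologyInstance φ → Axiom φ
  A2 : ∀ φ → Axiom (([1] ([ω] φ)) ⇔' ([ω] φ))
  A3 : ∀ a φ → Axiom ((¬' ([ a ] φ)) ⇔' ([ a ] (¬' φ)))
  A4 : ∀ a (o : BinOp) φ ψ →
       Axiom (([ a ] (bin o φ ψ)) ⇔' bin o ([ a ] φ) ([ a ] ψ))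
  A5 : ∀ φ ψ → Axiom (ψ ⇒' (φ u ψ))
  A6 : ∀ φ ψ → Axiom ((φ u ψ) ⇒' (φ U ψ))
  A7 : ∀ φ ψ n →
       Axiom ((⋀ n (λ k → ([ one ]^ k) (φ ∧' ¬' ψ))
               ∧' ([ one ]^ suc n) ψ) ⇒' (φ u ψ))
  A8 : ∀ φ ψ n →
       Axiom ((⋀ n (λ k → ([ omega ]^ k) (gF (φ ∧' ¬' ψ)))
               ∧' ([ omega ]^ suc n) (φ u ψ)) ⇒' (φ U ψ))

-- Derivations of countable-ordinal length are represented as
-- well-founded (countably branching) derivation trees, i.e. T ⊢ φ is
-- the least set containing axioms and T and closed under R1–R4, where
-- necessitation R2 is applied only to theorems (∅ ⊢ φ).

∅ : Formula → Set
∅ _ = ⊥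

data _⊢_ (T : Formula → Set) : Formula → Set₁ where
  ax  : ∀ {φ} → Axiom φ → T ⊢ φ
  hyp : ∀ {φ} → T φ → T ⊢ φ
  R1  : ∀ {φ ψ} → T ⊢ φ → T ⊢ (φ ⇒' ψ) → T ⊢ ψ
  R2  : ∀ {φ} a → ∅ ⊢ φ → T ⊢ ([ a ] φ)
  R3  : ∀ {θ φ ψ} →
        T ⊢ (θ ⇒' ¬' ψ) →
        ((n : ℕ) → T ⊢ (θ ⇒' (⋁ n (λ k → ([ one ]^ k) (¬' φ ∨' ψ))
                               ∨' ([ one ]^ suc n) (¬' ψ)))) →
        T ⊢ (θ ⇒' ¬' (φ u ψ))
  R4  : ∀ {θ φ ψ} →
        T ⊢ (θ ⇒' ¬' (φ u ψ)) →
        ((n : ℕ) → T ⊢ (θ ⇒' (⋁ n (λ k → ([ omega ]^ k) (¬' gF (φ ∧' ¬' ψ)))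
                               ∨' ([ omega ]^ suc n) (¬' (φ u ψ))))) →
        T ⊢ (θ ⇒' ¬' (φ U ψ))

infix 4 _⊢_

NonEmpty : (Formula → Set) → Set
NonEmpty T = ∃ λ φ → T φ

Consistent : (Formula → Set) → Set₁
Consistent T = ∀ χ → T ⊢ χ → T ⊢ ¬' χ → ⊥

record Complete (T : Formula → Set) : Set₁ where
  field
    consistent : Consistent T
    decide     : ∀ φ → (T ⊢ φ) ⊎ (T ⊢ ¬' φ)

Model : Set
Model = ℕ → ℕ → ℕ → Bool

Instant : Set
Instant = ℕ × ℕ

_≤lex_ : Instant → Instant → Set
(a , b) ≤lex (c , d) = (a < c) ⊎ ((a ≡ c) × (b ≤ d))

_<lex_ : Instant → Instant → Set
r <lex s = (r ≤lex s) × ¬ (r ≡ s)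

_⊨⟨_⟩_ : Model → Instant → Formula → Set
ξ ⊨⟨ r₁ , r₂ ⟩ var n = ξ r₁ r₂ n ≡ true
ξ ⊨⟨ r ⟩ (¬' φ) = ¬ (ξ ⊨⟨ r ⟩ φ)
ξ ⊨⟨ r ⟩ (φ ∧' ψ) = (ξ ⊨⟨ r ⟩ φ) × (ξ ⊨⟨ r ⟩ ψ)
ξ ⊨⟨ r₁ , r₂ ⟩ ([1] φ) = ξ ⊨⟨ r₁ , suc r₂ ⟩ φ
ξ ⊨⟨ r₁ , r₂ ⟩ ([ω] φ) = ξ ⊨⟨ suc r₁ , 0 ⟩ φ
ξ ⊨⟨ r₁ , r₂ ⟩ (φ u ψ) =
  Σ ℕ λ k → (ξ ⊨⟨ r₁ , r₂ + k ⟩ ψ) × (∀ i → i < k → ξ ⊨⟨ r₁ , r₂ + i ⟩ φ)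
ξ ⊨⟨ r ⟩ (φ U ψ) =
  Σ Instant λ s → (r ≤lex s) × (ξ ⊨⟨ s ⟩ ψ) ×
    (∀ t → r ≤lex t → t <lex s → ξ ⊨⟨ t ⟩ φ)

-- Canonical model of a complete theory:
--   ξ_T(k,l,p_n) = 1  iff  T ⊢ [ω]^k [1]^l p_n
-- (the completeness witness decides which case holds; consistency makes
-- this agree with provability).

isInj₁ : ∀ {a b} {A : Set a} {B : Set b} → A ⊎ B → Bool
isInj₁ (inj₁ _) = true
isInj₁ (inj₂ _) = false

canonical : (T : Formula → Set) → Complete T → Model
canonical T c k l n =
  isInj₁ (Complete.decide c (([ omega ]^ k) (([ one ]^ l) (var n))))

-- Atoms hold in the canonical
-- model by definition; ¬ and ∧ commute with the prefix [ω]^k [1]^l by A3 and A4, and a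
-- complete theory proves ¬χ exactly when it does not prove χ; the prefix of [1]φ at
-- ⟨k , l⟩ is literally that of φ at ⟨k , l+1⟩, and that of [ω]φ is provably that of φ
-- at ⟨k+1 , 0⟩ because A2 absorbs the [1]^l.

module Submission where

open import Defs
open import Data.Bool using (Bool; true; false; not; _∧_; T)
open import Data.Bool.Properties using (T-∧; T-≡)
open import Data.Empty using (⊥-elim)
open import Data.Nat using (ℕ; zero; suc)
open import Data.Product using (_,_; _×_; proj₁; proj₂)
open import Data.Product.Function.NonDependent.Propositional using (_×-⇔_)
open import Data.Sum using (_⊎_; inj₁; inj₂)
open import Function.Bundles using (_⇔_; mk⇔; Equivalence)
open import Function.Properties.Equivalence using () renaming (sym to ⇔-sym; trans to ⇔-trans)
open import Function.Related.TypeIsomorphisms using (¬-cong-⇔)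
open import Relation.Nullary using (¬_)
open import Relation.Binary.PropositionalEquality using (_≡_; refl; sym; cong; cong₂; subst; trans)

open Equivalence using (to)

assign₃ : {X : Set} → X → X → X → ℕ → X
assign₃ x y z 0 = x
assign₃ x y z 1 = y
assign₃ x y z _ = z

inThreeVars : PForm → Bool
inThreeVars (pv 0) = true
inThreeVars (pv 1) = true
inThreeVars (pv 2) = true
inThreeVars (pv _) = false
inThreeVars (pneg a) = inThreeVars a
inThreeVars (pand a b) = inThreeVars a ∧ inThreeVars b

evalP-assign₃ : ∀ v a → T (inThreeVars a) →
                evalP v a ≡ evalP (assign₃ (v 0) (v 1) (v 2)) a
evalP-assign₃ v (pv 0) _ = refl
evalP-assign₃ v (pv 1) _ = refl
evalP-assign₃ v (pv 2) _ = refl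
evalP-assign₃ v (pneg a) h = cong not (evalP-assign₃ v a h)
evalP-assign₃ v (pand a b) h =
  cong₂ _∧_ (evalP-assign₃ v a (proj₁ (to T-∧ h))) (evalP-assign₃ v b (proj₂ (to T-∧ h)))

allBool : (Bool → Bool) → Bool
allBool f = f true ∧ f false

allBool-sound : ∀ f → T (allBool f) → ∀ x → T (f x)
allBool-sound f h true = proj₁ (to T-∧ h)
allBool-sound f h false = proj₂ (to T-∧ h)

truthTable₃ : (Bool → Bool → Bool → Bool) → Bool
truthTable₃ f = allBool λ x → allBool λ y → allBool (f x y)

truthTable₃-sound : ∀ f → T (truthTable₃ f) → ∀ x y z → T (f x y z)
truthTable₃-sound f h x y =
  allBool-sound (f x y) (allBool-sound (λ y → allBool (f x y))
    (allBool-sound (λ x → allBool λ y → allBool (f x y)) h x) y)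

isTautology₃ : PForm → Bool
isTautology₃ a = inThreeVars a ∧ truthTable₃ λ x y z → evalP (assign₃ x y z) a

isTautology₃-sound : ∀ a → T (isTautology₃ a) → Tautology a
isTautology₃-sound a h v = trans (evalP-assign₃ v a (proj₁ split))
  (to T-≡ (truthTable₃-sound table (proj₂ split) (v 0) (v 1) (v 2)))
  where
  table : Bool → Bool → Bool → Bool
  table x y z = evalP (assign₃ x y z) a
  split : T (inThreeVars a) × T (truthTable₃ table)
  split = to (T-∧ {inThreeVars a} {truthTable₃ table}) h

-- The side condition T (isTautology₃ a) computes to ⊤ for a closed tautology a,
-- so it is filled in automatically at every use below.
⊢-tautology₃ : ∀ {Γ} (a : PForm) {_ : T (isTautology₃ a)} (A B C : Formula) →
               Γ ⊢ substP (assign₃ A B C) a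
⊢-tautology₃ a {h} A B C = ax (A1 (a , assign₃ A B C , isTautology₃-sound a h , refl))

p₀ p₁ p₂ : PForm
p₀ = pv 0
p₁ = pv 1
p₂ = pv 2

infixr 7 _∧ₚ_
infixr 5 _⇒ₚ_ _⇔ₚ_

_∧ₚ_ _⇒ₚ_ _⇔ₚ_ : PForm → PForm → PForm
a ∧ₚ b = pand a b
a ⇒ₚ b = pneg (a ∧ₚ pneg b)
a ⇔ₚ b = (a ⇒ₚ b) ∧ₚ (b ⇒ₚ a)

module _ {Γ : Formula → Set} where

  ⇔'-refl : ∀ {A} → Γ ⊢ A ⇔' A
  ⇔'-refl {A} = ⊢-tautology₃ (p₀ ⇔ₚ p₀) A A A

  ⇔'-sym : ∀ {A B} → Γ ⊢ A ⇔' B → Γ ⊢ B ⇔' A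
  ⇔'-sym {A} {B} A⇔B = R1 A⇔B (⊢-tautology₃ ((p₀ ⇔ₚ p₁) ⇒ₚ (p₁ ⇔ₚ p₀)) A B B)

  ⇔'-trans : ∀ {A B C} → Γ ⊢ A ⇔' B → Γ ⊢ B ⇔' C → Γ ⊢ A ⇔' C
  ⇔'-trans {A} {B} {C} A⇔B B⇔C =
    R1 B⇔C (R1 A⇔B (⊢-tautology₃ ((p₀ ⇔ₚ p₁) ⇒ₚ (p₁ ⇔ₚ p₂) ⇒ₚ (p₀ ⇔ₚ p₂)) A B C))

  ⇔'-mp : ∀ {A B} → Γ ⊢ A ⇔' B → Γ ⊢ A → Γ ⊢ B
  ⇔'-mp {A} {B} A⇔B ⊢A = R1 ⊢A (R1 A⇔B (⊢-tautology₃ ((p₀ ⇔ₚ p₁) ⇒ₚ p₀ ⇒ₚ p₁) A B B))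

  ⊢-cong-⇔' : ∀ {A B} → Γ ⊢ A ⇔' B → (Γ ⊢ A) ⇔ (Γ ⊢ B)
  ⊢-cong-⇔' A⇔B = mk⇔ (⇔'-mp A⇔B) (⇔'-mp (⇔'-sym A⇔B))

  ⊢-∧' : ∀ {A B} → (Γ ⊢ A ∧' B) ⇔ ((Γ ⊢ A) × (Γ ⊢ B))
  ⊢-∧' {A} {B} = mk⇔
    (λ ⊢A∧B → R1 ⊢A∧B (⊢-tautology₃ (p₀ ∧ₚ p₁ ⇒ₚ p₀) A B B)
            , R1 ⊢A∧B (⊢-tautology₃ (p₀ ∧ₚ p₁ ⇒ₚ p₁) A B B))
    (λ (⊢A , ⊢B) → R1 ⊢B (R1 ⊢A (⊢-tautology₃ (p₀ ⇒ₚ p₁ ⇒ₚ p₀ ∧ₚ p₁) A B B)))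

theorem⇒⊢ : ∀ {Γ φ} → ∅ ⊢ φ → Γ ⊢ φ
theorem⇒⊢ (ax φ) = ax φ
theorem⇒⊢ (hyp ())
theorem⇒⊢ (R1 p q) = R1 (theorem⇒⊢ p) (theorem⇒⊢ q)
theorem⇒⊢ (R2 a p) = R2 a p
theorem⇒⊢ (R3 p f) = R3 (theorem⇒⊢ p) (λ n → theorem⇒⊢ (f n))
theorem⇒⊢ (R4 p f) = R4 (theorem⇒⊢ p) (λ n → theorem⇒⊢ (f n))

[]-cong : ∀ a {A B} → ∅ ⊢ A ⇔' B → ∅ ⊢ [ a ] A ⇔' [ a ] B
[]-cong a {A} {B} A⇔B = ⇔'-mp (ax (A4 a opIff A B)) (R2 a A⇔B)

[]^-cong : ∀ a n {A B} → ∅ ⊢ A ⇔' B → ∅ ⊢ ([ a ]^ n) A ⇔' ([ a ]^ n) B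
[]^-cong a zero A⇔B = A⇔B
[]^-cong a (suc n) A⇔B = []-cong a ([]^-cong a n A⇔B)

[]^-¬' : ∀ a n φ → ∅ ⊢ ([ a ]^ n) (¬' φ) ⇔' ¬' ([ a ]^ n) φ
[]^-¬' a zero φ = ⇔'-refl
[]^-¬' a (suc n) φ = ⇔'-trans ([]-cong a ([]^-¬' a n φ)) (⇔'-sym (ax (A3 a (([ a ]^ n) φ))))

[]^-∧' : ∀ a n φ ψ → ∅ ⊢ ([ a ]^ n) (φ ∧' ψ) ⇔' ([ a ]^ n) φ ∧' ([ a ]^ n) ψ
[]^-∧' a zero φ ψ = ⇔'-refl
[]^-∧' a (suc n) φ ψ =
  ⇔'-trans ([]-cong a ([]^-∧' a n φ ψ)) (ax (A4 a opAnd (([ a ]^ n) φ) (([ a ]^ n) ψ)))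

[]^-suc : ∀ a n φ → ([ a ]^ n) ([ a ] φ) ≡ ([ a ]^ suc n) φ
[]^-suc a zero φ = refl
[]^-suc a (suc n) φ = cong ([ a ]_) ([]^-suc a n φ)

[1]^-[ω] : ∀ l φ → ∅ ⊢ ([ one ]^ l) ([ω] φ) ⇔' [ω] φ
[1]^-[ω] zero φ = ⇔'-refl
[1]^-[ω] (suc l) φ = ⇔'-trans ([]-cong one ([1]^-[ω] l φ)) (ax (A2 φ))

at : ℕ → ℕ → Formula → Formula
at k l φ = ([ omega ]^ k) (([ one ]^ l) φ)

at-¬' : ∀ k l φ → ∅ ⊢ at k l (¬' φ) ⇔' ¬' at k l φ
at-¬' k l φ = ⇔'-trans ([]^-cong omega k ([]^-¬' one l φ)) ([]^-¬' omega k _)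

at-∧' : ∀ k l φ ψ → ∅ ⊢ at k l (φ ∧' ψ) ⇔' at k l φ ∧' at k l ψ
at-∧' k l φ ψ = ⇔'-trans ([]^-cong omega k ([]^-∧' one l φ ψ)) ([]^-∧' omega k _ _)

at-[1] : ∀ k l φ → at k l ([1] φ) ≡ at k (suc l) φ
at-[1] k l φ = cong ([ omega ]^ k) ([]^-suc one l φ)

at-[ω] : ∀ k l φ → ∅ ⊢ at k l ([ω] φ) ⇔' at (suc k) 0 φ
at-[ω] k l φ = subst (λ χ → ∅ ⊢ at k l ([ω] φ) ⇔' χ) ([]^-suc omega k φ)
  ([]^-cong omega k ([1]^-[ω] l φ))

module _ {Γ : Formula → Set} (c : Complete Γ) where

  open Complete c

  ⊢-¬' : ∀ {φ} → (Γ ⊢ ¬' φ) ⇔ (¬ (Γ ⊢ φ))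
  ⊢-¬' {φ} = mk⇔ (λ ⊢¬φ ⊢φ → consistent φ ⊢φ ⊢¬φ) (decide-¬ (decide φ))
    where
    decide-¬ : (Γ ⊢ φ) ⊎ (Γ ⊢ ¬' φ) → ¬ (Γ ⊢ φ) → Γ ⊢ ¬' φ
    decide-¬ (inj₁ ⊢φ) ⊬φ = ⊥-elim (⊬φ ⊢φ)
    decide-¬ (inj₂ ⊢¬φ) _ = ⊢¬φ

  canonical-var : ∀ k l n → (canonical Γ c ⊨⟨ k , l ⟩ var n) ⇔ (Γ ⊢ at k l (var n))
  canonical-var k l n with decide (at k l (var n))
  ... | inj₁ ⊢p = mk⇔ (λ _ → ⊢p) (λ _ → refl)
  ... | inj₂ ⊢¬p = mk⇔ (λ ()) (λ ⊢p → ⊥-elim (consistent _ ⊢p ⊢¬p))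

  truth-lemma : ∀ {φ} → IsL φ → ∀ k l → (canonical Γ c ⊨⟨ k , l ⟩ φ) ⇔ (Γ ⊢ at k l φ)
  truth-lemma (var n) k l = canonical-var k l n
  truth-lemma (neg {φ} h) k l =
    ⇔-trans (¬-cong-⇔ (truth-lemma h k l))
    (⇔-trans (⇔-sym ⊢-¬') (⊢-cong-⇔' (⇔'-sym (theorem⇒⊢ (at-¬' k l φ)))))
  truth-lemma (and {φ} {ψ} h g) k l =
    ⇔-trans (truth-lemma h k l ×-⇔ truth-lemma g k l)
    (⇔-trans (⇔-sym ⊢-∧') (⊢-cong-⇔' (⇔'-sym (theorem⇒⊢ (at-∧' k l φ ψ)))))
  truth-lemma (nx1 {φ} h) k l =
    subst (λ χ → (canonical Γ c ⊨⟨ k , suc l ⟩ φ) ⇔ (Γ ⊢ χ)) (sym (at-[1] k l φ))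
      (truth-lemma h k (suc l))
  truth-lemma (nxω {φ} h) k l =
    ⇔-trans (truth-lemma h (suc k) 0) (⊢-cong-⇔' (⇔'-sym (theorem⇒⊢ (at-[ω] k l φ))))

mainTheorem8 : (T : Formula → Set) → NonEmpty T → (c : Complete T) →
    (φ : Formula) → IsL φ → (k l : ℕ) →
    (canonical T c ⊨⟨ k , l ⟩ φ) ⇔ (T ⊢ ([ omega ]^ k) (([ one ]^ l) φ))
mainTheorem8 T _ c _ = truth-lemma c
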